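{- Let $t\ge1$ and let $f:\{0,1\}^n\to\{0,1\}$ be given by a compact form DNF representation of size $d_\vee$ with the $t$-block property. Then $\mathrm{bs}_0(f)\le d_\vee$.
   Context: For $x\in\{0,1\}^n$ and $B\subseteq[n]$, $x^B$ flips the bits of $x$ in $B$; $\mathrm{bs}(f,x)$ is the maximum number of pairwise disjoint $B\subseteq[n]$ with $f(x^B)\ne f(x)$; $\mathrm{bs}_0(f)=\max_{f(x)=0}\mathrm{bs}(f,x)$. A DNF representation is an OR of $d_\vee$ terms $\wedge_1,\dots,\wedge_{d_\vee}$ (size $d_\vee$), each an AND of literals with no term containing a variable and its negation; $A_i$ (resp. $\overline{A}_i$) is the set of variables unnegated (resp. negated) in $\wedge_i$; $S_i$ is the set of assignments satisfying $\wedge_i$. Compact form: (a) $f(0^n)=0$, (b) $\mathrm{bs}_0(f)=\mathrm{bs}(f,0^n)$, (c) $S_i\setminus\bigcup_{j\ne i}S_j\ne\emptyset$ for all $i$. $t$-block property: every variable $x$ lies in $A_i$ for at most $t$ indices $i$. -}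

module Defs where

open import Data.Nat using (ℕ; zero; suc; _+_; _≤_)
open import Data.Fin using (Fin; zero; suc)
open import Data.Bool using (Bool; true; false; _∧_; _∨_; _xor_; not; if_then_else_)
open import Data.Maybe using (Maybe; just; nothing)
open import Data.Product using (Σ; _×_)
open import Relation.Binary.PropositionalEquality using (_≡_; _≢_)
open import Relation.Nullary using (¬_)

-- Points of the Boolean cube {0,1}^n ; false = 0, true = 1.
Point : ℕ → Set
Point n = Fin n → Bool

BoolFun : ℕ → Set
BoolFun n = Point n → Bool

-- A subset B ⊆ [n], as its characteristic function.
Block : ℕ → Set
Block n = Fin n → Bool

flipB : ∀ {n} → Point n → Block n → Point n
flipB x B j = x j xor B j

allF : ∀ {k} → (Fin k → Bool) → Bool
allF {zero}  p = true
allF {suc k} p = p zero ∧ allF (λ i → p (suc i))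

anyF : ∀ {k} → (Fin k → Bool) → Bool
anyF {zero}  p = false
anyF {suc k} p = p zero ∨ anyF (λ i → p (suc i))

countF : ∀ {k} → (Fin k → Bool) → ℕ
countF {zero}  p = 0
countF {suc k} p = (if p zero then 1 else 0) + countF (λ i → p (suc i))

-- A term (AND of literals) over n variables: for each variable,
-- nothing = absent, just true = unnegated literal (in A_i),
-- just false = negated literal (in Ā_i).  A variable can never occur
-- both negated and unnegated.
Term : ℕ → Set
Term n = Fin n → Maybe Bool

DNF : ℕ → ℕ → Set
DNF d n = Fin d → Term n

litOK : Maybe Bool → Bool → Bool
litOK nothing  b = true
litOK (just c) b = not (c xor b)

satTerm : ∀ {n} → Term n → Point n → Bool
satTerm T x = allF (λ j → litOK (T j) (x j))

Sat : ∀ {d n} → DNF d n → Fin d → Point n → Set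
Sat φ i x = satTerm (φ i) x ≡ true

evalDNF : ∀ {d n} → DNF d n → BoolFun n
evalDNF φ x = anyF (λ i → satTerm (φ i) x)

Sensitive : ∀ {n} → BoolFun n → Point n → Block n → Set
Sensitive f x B = f (flipB x B) ≢ f x

Disjoint : ∀ {n} → Block n → Block n → Set
Disjoint B C = ∀ j → B j ≡ true → C j ≡ false

HasDisjSens : ∀ {n} → BoolFun n → Point n → ℕ → Set
HasDisjSens {n} f x k =
  Σ (Fin k → Block n) λ Bs →
    (∀ a → Sensitive f x (Bs a)) × (∀ a b → a ≢ b → Disjoint (Bs a) (Bs b))

bsLe : ∀ {n} → BoolFun n → Point n → ℕ → Set
bsLe f x m = ∀ k → HasDisjSens f x k → k ≤ m

bs0Le : ∀ {n} → BoolFun n → ℕ → Set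
bs0Le f m = ∀ x → f x ≡ false → bsLe f x m

zeroPt : ∀ {n} → Point n
zeroPt _ = false

-- bs₀(f) = bs(f,0ⁿ), given f(0ⁿ) = 0: every x with f x = 0 has
-- bs(f,x) ≤ bs(f,0ⁿ).
bs0AtZero : ∀ {n} → BoolFun n → Set
bs0AtZero f = ∀ x → f x ≡ false → ∀ k → HasDisjSens f x k → HasDisjSens f zeroPt k

Compact : ∀ {d n} → DNF d n → Set
Compact {d} {n} φ =
  (evalDNF φ zeroPt ≡ false)
  × bs0AtZero (evalDNF φ)
  × (∀ i → Σ (Point n) λ x → Sat φ i x × (∀ j → j ≢ i → ¬ Sat φ j x))

isPos : Maybe Bool → Bool
isPos (just true) = true
isPos _           = false

TBlock : ∀ {d n} → ℕ → DNF d n → Set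
TBlock t φ = ∀ v → countF (λ i → isPos (φ i v)) ≤ t

module Submission where

-- A sensitive block B at 0ⁿ is a point satisfying some term of the DNF. If two disjoint
-- blocks were satisfied by the same term, that term would also be satisfied by their
-- pointwise meet 0ⁿ, contradicting f(0ⁿ) = 0. So choosing a satisfied term for each block
-- is injective and bs(f,0ⁿ) ≤ d; compactness (b) moves this to every zero of f.

open import Defs
open import Data.Nat using (ℕ; zero; suc; _≤_)
open import Data.Fin using (Fin; zero; suc; _≟_)
open import Data.Fin.Properties using (injective⇒≤)
open import Data.Bool using (Bool; true; false; _∧_)
open import Data.Bool.Properties using (¬-not; not-¬)
open import Data.Maybe using (just; nothing)
open import Data.Product using (∃; _,_; proj₁; proj₂)
open import Data.Empty using (⊥-elim)
open import Relation.Binary.PropositionalEquality using (_≡_; _≢_; refl; sym; subst)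
open import Relation.Nullary using (yes; no)

anyF-true⇒∃ : ∀ {k} (p : Fin k → Bool) → anyF p ≡ true → ∃ λ i → p i ≡ true
anyF-true⇒∃ {suc k} p any with p zero in eq
... | true  = zero , eq
... | false with anyF-true⇒∃ (λ i → p (suc i)) any
...   | i , pi = suc i , pi

∃⇒anyF-true : ∀ {k} (p : Fin k → Bool) i → p i ≡ true → anyF p ≡ true
∃⇒anyF-true p zero    pi rewrite pi = refl
∃⇒anyF-true p (suc i) pi with p zero
... | true  = refl
... | false = ∃⇒anyF-true (λ i → p (suc i)) i pi

allF-true⇒∀ : ∀ {k} (p : Fin k → Bool) → allF p ≡ true → ∀ i → p i ≡ true
allF-true⇒∀ p all zero    with p zero
... | true = refl
allF-true⇒∀ p all (suc i) with p zero
... | true = allF-true⇒∀ (λ i → p (suc i)) all i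

∀⇒allF-true : ∀ {k} (p : Fin k → Bool) → (∀ i → p i ≡ true) → allF p ≡ true
∀⇒allF-true {zero}  p all = refl
∀⇒allF-true {suc k} p all rewrite all zero = ∀⇒allF-true (λ i → p (suc i)) (λ i → all (suc i))

litOK-∧ : ∀ m {b c} → litOK m b ≡ true → litOK m c ≡ true → litOK m (b ∧ c) ≡ true
litOK-∧ nothing      _ _ = refl
litOK-∧ (just true)  {true}  {true} _ _ = refl
litOK-∧ (just false) {false}        _ _ = refl

disjoint⇒∧≡false : ∀ {n} {B C : Block n} → Disjoint B C → ∀ j → B j ∧ C j ≡ false
disjoint⇒∧≡false {B = B} disj j with B j in eq
... | true  = disj j eq
... | false = refl

satTerm-disjoint⇒zero : ∀ {n} (T : Term n) {B C : Block n} → Disjoint B C →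
                        satTerm T B ≡ true → satTerm T C ≡ true → satTerm T zeroPt ≡ true
satTerm-disjoint⇒zero T disj satB satC = ∀⇒allF-true _ λ j →
  subst (λ b → litOK (T j) b ≡ true) (disjoint⇒∧≡false disj j)
        (litOK-∧ (T j) (allF-true⇒∀ _ satB j) (allF-true⇒∀ _ satC j))

bs-at-zero≤size : ∀ {d n} (φ : DNF d n) → evalDNF φ zeroPt ≡ false → bsLe (evalDNF φ) zeroPt d
bs-at-zero≤size {d} φ f0 k (Bs , sensitive , disjoint) = injective⇒≤ witness-injective
  where
  -- flipB zeroPt B is definitionally B.
  satisfied : ∀ a → evalDNF φ (Bs a) ≡ true
  satisfied a = ¬-not (subst (evalDNF φ (Bs a) ≢_) f0 (sensitive a))

  satisfying-term : ∀ a → ∃ λ i → Sat φ i (Bs a)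
  satisfying-term a = anyF-true⇒∃ (λ i → satTerm (φ i) (Bs a)) (satisfied a)

  witness : Fin k → Fin d
  witness a = proj₁ (satisfying-term a)

  witness-sat : ∀ a → Sat φ (witness a) (Bs a)
  witness-sat a = proj₂ (satisfying-term a)

  witness-injective : ∀ {a b} → witness a ≡ witness b → a ≡ b
  witness-injective {a} {b} same with a ≟ b
  ... | yes a≡b = a≡b
  ... | no  a≢b = ⊥-elim (not-¬ (∃⇒anyF-true (λ i → satTerm (φ i) zeroPt) (witness a) zero-sat) f0)
    where
    zero-sat : Sat φ (witness a) zeroPt
    zero-sat = satTerm-disjoint⇒zero (φ (witness a)) (disjoint a b a≢b) (witness-sat a)
                 (subst (λ i → Sat φ i (Bs b)) (sym same) (witness-sat b))

lemma7 : (t n d : ℕ) → 1 ≤ t → (φ : DNF d n) → Compact φ → TBlock t φ → bs0Le (evalDNF φ) d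
lemma7 t n d _ φ (f0 , bs0-at-zero , _) _ x fx k sensBlocks =
  bs-at-zero≤size φ f0 k (bs0-at-zero x fx k sensBlocks)
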